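{- Let $G=([n],E)$ be a terrain-like graph and let $\{x,y\}\in E$ with $x<y$ be a $\preceq$-minimal edge (no $e\in E$, $e\ne\{x,y\}$, satisfies $e\preceq\{x,y\}$). Then $2x$ and $2y-1$ are in edge configuration in $\Pi(G)$.
   Context: $[n]=\{1,\dots,n\}$; $\mathcal{S}_{2n}$ is the symmetric group on $[2n]$, with product meaning composition, $(\sigma\rho)(x)=\sigma(\rho(x))$; $(a,b)$ denotes a transposition. A graph $G=([n],E)$ is terrain-like if for all $a<b<c<d$, $\{a,c\},\{b,d\}\in E$ implies $\{a,d\}\in E$. On $\binom{[n]}{2}$ define $\preceq$ by: for $a<b$, $c<d$, $\{a,b\}\preceq\{c,d\}$ iff $c\le a<b\le d$. A valid ordering of $E$ is a total order $\le$ on $E$ with $e\preceq e'\Rightarrow e\le e'$. For $a<b$ let $\tau(\{a,b\})=(2a,2b-1)$ and $\pi_0=(1,2)(3,4)\cdots(2n-1,2n)$. For $E=\{e_1>\dots>e_m\}$ in a valid ordering, $\Pi(G)=\tau(e_m)\cdots\tau(e_1)\pi_0$ (independent of the valid ordering). For $\sigma\in\mathcal{S}_{2n}$ and $2\le i<j\le 2n-1$ with $i$ even and $j$ odd, $i$ and $j$ are in edge configuration in $\sigma$ if ($\sigma^{ -1}(i)<\sigma^{ -1}(j)$ iff $\sigma^{ -1}(i)\equiv\sigma^{ -1}(j)\pmod 2$); otherwise in non-edge configuration. -}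

module Defs where

open import Data.Nat using (ℕ; zero; suc; _+_; _*_; _∸_; _≤_; _<_; _≡ᵇ_)
open import Data.Nat.DivMod using (_%_)
open import Data.Bool using (Bool; true; false; if_then_else_)
open import Data.Product using (_×_; _,_; proj₁; proj₂)
open import Data.List using (List; map; upTo; concatMap; filterᵇ; foldr)
open import Relation.Binary.PropositionalEquality using (_≡_)
open import Function.Bundles using (_⇔_)

-- A graph on vertex set [n] = {1..n} is given by a Bool-valued adjacency
-- function E : ℕ → ℕ → Bool ; for 1 ≤ a < b ≤ n, {a,b} ∈ E iff E a b ≡ true.
-- (Values of E outside 1 ≤ a < b ≤ n are ignored.)
Adj : Set
Adj = ℕ → ℕ → Bool

TerrainLike : ℕ → Adj → Set
TerrainLike n E = ∀ a b c d → 1 ≤ a → a < b → b < c → c < d → d ≤ n →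
  E a c ≡ true → E b d ≡ true → E a d ≡ true

_⪯_ : ℕ × ℕ → ℕ × ℕ → Set
(a , b) ⪯ (c , d) = c ≤ a × a < b × b ≤ d

-- Permutations of [2n] are represented as functions ℕ → ℕ (only values on
-- 1..2n matter).  Product = composition.
-- transposition (i , j)
swap : ℕ → ℕ → ℕ → ℕ
swap i j k = if k ≡ᵇ i then j else (if k ≡ᵇ j then i else k)

τ : ℕ × ℕ → ℕ → ℕ
τ (a , b) = swap (2 * a) (2 * b ∸ 1)

-- π₀ = (1,2)(3,4)...(2n-1,2n)
π₀ : ℕ → ℕ
π₀ zero = zero
π₀ (suc k) = if (suc k) % 2 ≡ᵇ 1 then suc (suc k) else k

-- all pairs (a , a+len) with 1 ≤ a, a+len ≤ n, listed by increasing length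
-- len = 1..n-1; this is a valid ordering (a linear extension of ⪯) listed
-- from smallest to largest.
pairsOfLen : ℕ → ℕ → List (ℕ × ℕ)
pairsOfLen n len = map (λ a → (a , a + len)) (map suc (upTo (n ∸ len)))

allPairs : ℕ → List (ℕ × ℕ)
allPairs n = concatMap (pairsOfLen n) (map suc (upTo (n ∸ 1)))

-- the edges of G listed increasingly in a valid ordering: e_m, ..., e_1
edgeList : ℕ → Adj → List (ℕ × ℕ)
edgeList n E = filterᵇ (λ p → E (proj₁ p) (proj₂ p)) (allPairs n)

-- Π(G) = τ(e_m) ⋯ τ(e_1) π₀
Π : ℕ → Adj → ℕ → ℕ
Π n E = foldr (λ p f k → τ p (f k)) π₀ (edgeList n E)

-- i and j are in edge configuration in σ ∈ S_{2n}:
-- σ⁻¹(i) < σ⁻¹(j) iff σ⁻¹(i) ≡ σ⁻¹(j) (mod 2).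
-- σ⁻¹(i) is expressed as the (unique, σ being a permutation) position
-- p ∈ [2n] with σ p ≡ i.
EdgeConfig : ℕ → (ℕ → ℕ) → ℕ → ℕ → Set
EdgeConfig n σ i j = ∀ p q → 1 ≤ p → p ≤ 2 * n → 1 ≤ q → q ≤ 2 * n →
  σ p ≡ i → σ q ≡ j → (p < q ⇔ (p % 2 ≡ q % 2))

{-# OPTIONS --safe #-}
-- Since Π(G)⁻¹ = π₀ τ(e₁) ⋯ τ(e_m), the positions of 2x and 2y − 1 in Π(G) are found by
-- pushing both values through τ(e) for the edges e in increasing order ("unwinding") and
-- applying π₀ at the end. By minimality the edges before {x, y} fix both values, and τ(x, y)
-- exchanges them. From then on each value is a token on the odd slot 2r − 1 or the even slot
-- 2l of an edge {l, r} with l ≤ x < y ≤ r, and τ(a, b) hands a token on 2b − 1 or 2a over to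
-- the longer edge {a, b}. A relation between the two tokens' edges, preserved step by step
-- thanks to the terrain-like property, leaves them in edge configuration once all edges
-- have been applied.
module Submission where

open import Defs
open import Data.Nat using (ℕ; zero; suc; pred; _+_; _*_; _∸_; _≤_; _<_; _≡ᵇ_; z≤n; s≤s)
open import Data.Nat.Properties
open import Data.Nat.DivMod using (_%_; m*n%n≡0; [m+kn]%n≡m%n)
open import Data.Bool using (true; false)
open import Data.Product using (_×_; _,_; ∃; Σ; proj₁; proj₂)
open import Data.Sum using (_⊎_; inj₁; inj₂)
open import Data.Empty using (⊥-elim)
open import Relation.Nullary using (¬_; yes; no)
open import Relation.Binary.PropositionalEquality
open import Data.Nat.Tactic.RingSolver using (solve-∀)
open import Data.List using (List; []; _∷_; _++_; foldr; foldl)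
open import Data.List.Properties using (foldl-++)
open import Data.List.Relation.Unary.All using (All; []; _∷_; zipWith)
import Data.List.Relation.Unary.All as All
import Data.List.Relation.Unary.All.Properties as All
open import Data.List.Relation.Unary.AllPairs using (AllPairs; _∷_)
import Data.List.Relation.Unary.AllPairs as AllPairs
import Data.List.Relation.Unary.AllPairs.Properties as AllPairs
open import Data.List.Membership.Propositional using (_∈_)
open import Data.List.Relation.Unary.Any using (here; there)
open import Data.List.Membership.Propositional.Properties using (∈-filter⁺; ∈-concat⁺′; ∈-map⁺; ∈-upTo⁺; ∈-++⁻; ∈-∃++)
open import Data.Bool.Properties using (T-≡)
open import Function.Base using (_∘_)
open import Function.Bundles using (Equivalence; _⇔_; mk⇔)

≡ᵇ-true : ∀ {m n} → m ≡ n → (m ≡ᵇ n) ≡ true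
≡ᵇ-true {m} {n} m≡n with m ≡ᵇ n | ≡⇒≡ᵇ m n m≡n
... | true | _ = refl

≡ᵇ-false : ∀ {m n} → m ≢ n → (m ≡ᵇ n) ≡ false
≡ᵇ-false {m} {n} m≢n with m ≡ᵇ n | ≡ᵇ⇒≡ m n
... | false | _ = refl
... | true | m≡n = ⊥-elim (m≢n (m≡n _))

swap-left : ∀ i j → swap i j i ≡ j
swap-left i j rewrite ≡ᵇ-true {i} refl = refl

swap-right : ∀ i j → swap i j j ≡ i
swap-right i j with j ≟ i
... | yes refl = swap-left j j
... | no j≢i rewrite ≡ᵇ-false j≢i | ≡ᵇ-true {j} refl = refl

swap-other : ∀ {i j k} → k ≢ i → k ≢ j → swap i j k ≡ k
swap-other k≢i k≢j rewrite ≡ᵇ-false k≢i | ≡ᵇ-false k≢j = refl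

swap-involutive : ∀ i j k → swap i j (swap i j k) ≡ k
swap-involutive i j k with k ≟ i | k ≟ j
... | yes refl | _ = trans (cong (swap k j) (swap-left k j)) (swap-right k j)
... | no k≢i | yes refl = trans (cong (swap i k) (swap-right i k)) (swap-left i k)
... | no k≢i | no k≢j = trans (cong (swap i j) (swap-other k≢i k≢j)) (swap-other k≢i k≢j)

2*suc∸1 : ∀ r → 2 * suc r ∸ 1 ≡ suc (2 * r)
2*suc∸1 r = cong pred (*-suc 2 r)

even≢2*∸1 : ∀ l {r} → 1 ≤ r → 2 * l ≢ 2 * r ∸ 1
even≢2*∸1 l {suc r} _ eq = even≢odd l r (trans eq (2*suc∸1 r))

2*∸1-injective : ∀ {r b} → 1 ≤ r → 1 ≤ b → 2 * r ∸ 1 ≡ 2 * b ∸ 1 → r ≡ b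
2*∸1-injective {suc r} {suc b} _ _ eq =
  cong suc (*-cancelˡ-≡ r b 2 (suc-injective (trans (sym (2*suc∸1 r)) (trans eq (2*suc∸1 b)))))

2*-%2 : ∀ m → (2 * m) % 2 ≡ 0
2*-%2 m = trans (cong (_% 2) (*-comm 2 m)) (m*n%n≡0 m 2)

suc-2*-%2 : ∀ m → suc (2 * m) % 2 ≡ 1
suc-2*-%2 m = trans (cong (λ k → suc k % 2) (*-comm 2 m)) ([m+kn]%n≡m%n 1 m 2)

2*∸1-%2 : ∀ {m} → 1 ≤ m → (2 * m ∸ 1) % 2 ≡ 1
2*∸1-%2 {suc m} _ = trans (cong (_% 2) (2*suc∸1 m)) (suc-2*-%2 m)

2*∸1<2*∸1 : ∀ {l m} → 1 ≤ l → l < m → 2 * l ∸ 1 < 2 * m ∸ 1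
2*∸1<2*∸1 {suc l} {suc m} _ (s≤s l<m) rewrite 2*suc∸1 l | 2*suc∸1 m = s≤s (*-monoʳ-< 2 l<m)

2*∸1<2* : ∀ {l m} → 1 ≤ l → l ≤ m → 2 * l ∸ 1 < 2 * m
2*∸1<2* {suc l} _ l≤m rewrite 2*suc∸1 l = ≤-trans (≤-reflexive (sym (*-suc 2 l))) (*-monoʳ-≤ 2 l≤m)

even-or-odd : ∀ p → ∃ λ m → p ≡ 2 * m ⊎ p ≡ suc (2 * m)
even-or-odd zero = 0 , inj₁ refl
even-or-odd (suc p) with even-or-odd p
... | m , inj₁ refl = m , inj₂ refl
... | m , inj₂ refl = suc m , inj₁ (sym (*-suc 2 m))

π₀-of-odd : ∀ {k} → suc k % 2 ≡ 1 → π₀ (suc k) ≡ suc (suc k)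
π₀-of-odd eq rewrite eq = refl

π₀-of-even : ∀ {k} → suc k % 2 ≡ 0 → π₀ (suc k) ≡ k
π₀-of-even eq rewrite eq = refl

π₀-odd : ∀ {r} → 1 ≤ r → π₀ (2 * r ∸ 1) ≡ 2 * r
π₀-odd {suc r} _ = begin
  π₀ (2 * suc r ∸ 1)      ≡⟨ cong π₀ (2*suc∸1 r) ⟩
  π₀ (suc (2 * r))        ≡⟨ π₀-of-odd (suc-2*-%2 r) ⟩
  suc (suc (2 * r))       ≡⟨ sym (*-suc 2 r) ⟩
  2 * suc r               ∎
  where open ≡-Reasoning

π₀-even : ∀ {l} → 1 ≤ l → π₀ (2 * l) ≡ 2 * l ∸ 1
π₀-even {suc l} _ = begin
  π₀ (2 * suc l)          ≡⟨ cong π₀ (*-suc 2 l) ⟩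
  π₀ (suc (suc (2 * l)))  ≡⟨ π₀-of-even (trans (cong (_% 2) (sym (*-suc 2 l))) (2*-%2 (suc l))) ⟩
  suc (2 * l)             ≡⟨ sym (2*suc∸1 l) ⟩
  2 * suc l ∸ 1           ∎
  where open ≡-Reasoning

π₀-involutive : ∀ {p} → 1 ≤ p → π₀ (π₀ p) ≡ p
π₀-involutive {p} p≥1 with even-or-odd p
π₀-involutive () | zero , inj₁ refl
... | suc m , inj₁ refl = trans (cong π₀ (π₀-even {suc m} (s≤s z≤n))) (π₀-odd {suc m} (s≤s z≤n))
... | m , inj₂ refl = subst (λ p → π₀ (π₀ p) ≡ p) (2*suc∸1 m)
  (trans (cong π₀ (π₀-odd {suc m} (s≤s z≤n))) (π₀-even {suc m} (s≤s z≤n)))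

infix 4 _≺_

-- (a , b) ≺ (c , d): b − a < d − c, or b − a ≡ d − c and a < c, written without subtraction.
-- This is the order in which edgeList enumerates the pairs.
_≺_ : ℕ × ℕ → ℕ × ℕ → Set
(a , b) ≺ (c , d) = b + c < d + a ⊎ (b + c ≡ d + a × a < c)

private
  regroupˡ : ∀ b c d e → (b + c) + (d + e) ≡ (b + e) + (c + d)
  regroupˡ = solve-∀

  regroupʳ : ∀ a c d f → (d + a) + (f + c) ≡ (f + a) + (c + d)
  regroupʳ = solve-∀

  length-<-≤-trans : ∀ {a b c d e f} → b + c < d + a → d + e ≤ f + c → b + e < f + a
  length-<-≤-trans {a} {b} {c} {d} {e} {f} p q = +-cancelʳ-< (c + d) (b + e) (f + a)
    (subst₂ _<_ (regroupˡ b c d e) (regroupʳ a c d f) (+-mono-<-≤ p q))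

  length-≤-<-trans : ∀ {a b c d e f} → b + c ≤ d + a → d + e < f + c → b + e < f + a
  length-≤-<-trans {a} {b} {c} {d} {e} {f} p q = +-cancelʳ-< (c + d) (b + e) (f + a)
    (subst₂ _<_ (regroupˡ b c d e) (regroupʳ a c d f) (+-mono-≤-< p q))

  length-≡-trans : ∀ {a b c d e f} → b + c ≡ d + a → d + e ≡ f + c → b + e ≡ f + a
  length-≡-trans {a} {b} {c} {d} {e} {f} p q = +-cancelʳ-≡ (c + d) (b + e) (f + a)
    (trans (sym (regroupˡ b c d e)) (trans (cong₂ _+_ p q) (regroupʳ a c d f)))

≺-trans : ∀ {u v w} → u ≺ v → v ≺ w → u ≺ w
≺-trans {a , b} {c , d} {e , f} (inj₁ p) (inj₁ q) = inj₁ (length-<-≤-trans {a} {b} {c} {d} {e} {f} p (<⇒≤ q))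
≺-trans {a , b} {c , d} {e , f} (inj₁ p) (inj₂ (q , _)) = inj₁ (length-<-≤-trans {a} {b} {c} {d} {e} {f} p (≤-reflexive q))
≺-trans {a , b} {c , d} {e , f} (inj₂ (p , _)) (inj₁ q) = inj₁ (length-≤-<-trans {a} {b} {c} {d} {e} {f} (≤-reflexive p) q)
≺-trans {a , b} {c , d} {e , f} (inj₂ (p , a<c)) (inj₂ (q , c<e)) =
  inj₂ (length-≡-trans {a} {b} {c} {d} {e} {f} p q , <-trans a<c c<e)

≺-irrefl : ∀ {u} → ¬ u ≺ u
≺-irrefl (inj₁ p) = <-irrefl refl p
≺-irrefl (inj₂ (_ , p)) = <-irrefl refl p

≺-asym : ∀ {u v} → u ≺ v → ¬ v ≺ u
≺-asym p q = ≺-irrefl (≺-trans p q)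

≺⇒length≤ : ∀ {a b c d} → (a , b) ≺ (c , d) → b + c ≤ d + a
≺⇒length≤ (inj₁ p) = <⇒≤ p
≺⇒length≤ (inj₂ (p , _)) = ≤-reflexive p

<⇒≺-sameLeft : ∀ {a r b} → r < b → (a , r) ≺ (a , b)
<⇒≺-sameLeft {a} r<b = inj₁ (+-monoˡ-< a r<b)

≺-sameLeft⇒< : ∀ {a r b} → (a , r) ≺ (a , b) → r < b
≺-sameLeft⇒< {a} {r} {b} (inj₁ p) = +-cancelʳ-< a r b p
≺-sameLeft⇒< (inj₂ (_ , a<a)) = ⊥-elim (<-irrefl refl a<a)

>⇒≺-sameRight : ∀ {a l b} → a < l → (l , b) ≺ (a , b)
>⇒≺-sameRight {b = b} a<l = inj₁ (+-monoʳ-< b a<l)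

≺-sameRight⇒> : ∀ {a l b} → (l , b) ≺ (a , b) → a < l
≺-sameRight⇒> {a} {l} {b} (inj₁ p) = +-cancelˡ-< b a l p
≺-sameRight⇒> {a} {l} {b} (inj₂ (p , l<a)) = ⊥-elim (<-irrefl (+-cancelˡ-≡ b l a (sym p)) l<a)

≺-endsLater⇒startsLater : ∀ {a l r r′} → r < r′ → (l , r′) ≺ (a , r) → a < l
≺-endsLater⇒startsLater {a} {l} {r} {r′} r<r′ p =
  +-cancelˡ-< r′ a l (≤-<-trans (≺⇒length≤ p) (+-monoˡ-< l r<r′))

≺-startsEarlier⇒endsEarlier : ∀ {l l′ r b} → l < l′ → (l , r) ≺ (l′ , b) → r < b
≺-startsEarlier⇒endsEarlier {l} {l′} {r} {b} l<l′ p =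
  +-cancelʳ-< l′ r b (≤-<-trans (≺⇒length≤ p) (+-monoʳ-< b l<l′))

τ-on-odd : ∀ {l r a b} → 1 ≤ r → 1 ≤ b → (l , r) ≺ (a , b) →
  (b ≡ r × a < l × τ (a , b) (2 * r ∸ 1) ≡ 2 * a) ⊎ (b ≢ r × τ (a , b) (2 * r ∸ 1) ≡ 2 * r ∸ 1)
τ-on-odd {l} {r} {a} {b} r≥1 b≥1 lr≺ab with b ≟ r
... | yes refl = inj₁ (refl , ≺-sameRight⇒> lr≺ab , swap-right (2 * a) (2 * b ∸ 1))
... | no b≢r = inj₂ (b≢r , swap-other (λ eq → even≢2*∸1 a r≥1 (sym eq))
                                       (λ eq → b≢r (sym (2*∸1-injective r≥1 b≥1 eq))))

τ-on-even : ∀ {l r a b} → 1 ≤ b → (l , r) ≺ (a , b) →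
  (a ≡ l × r < b × τ (a , b) (2 * l) ≡ 2 * b ∸ 1) ⊎ (a ≢ l × τ (a , b) (2 * l) ≡ 2 * l)
τ-on-even {l} {r} {a} {b} b≥1 lr≺ab with a ≟ l
... | yes refl = inj₁ (refl , ≺-sameLeft⇒< lr≺ab , swap-left (2 * a) (2 * b ∸ 1))
... | no a≢l = inj₂ (a≢l , swap-other (λ eq → a≢l (sym (*-cancelˡ-≡ l a 2 eq))) (even≢2*∸1 l b≥1))

unwind : List (ℕ × ℕ) → ℕ → ℕ
unwind es v = foldl (λ w e → τ e w) v es

unwind-inverts : ∀ es {p v} → foldr (λ e f k → τ e (f k)) π₀ es p ≡ v → π₀ p ≡ unwind es v
unwind-inverts [] eq = eq
unwind-inverts (e ∷ es) eq =
  unwind-inverts es (trans (sym (swap-involutive _ _ _)) (cong (τ e) eq))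

unwind-++ : ∀ es fs v → unwind (es ++ fs) v ≡ unwind fs (unwind es v)
unwind-++ es fs v = foldl-++ (λ w e → τ e w) v es fs

unwind-fixed : ∀ {es v} → All (λ e → τ e v ≡ v) es → unwind es v ≡ v
unwind-fixed [] = refl
unwind-fixed {e ∷ es} (τv≡v ∷ fixed) rewrite τv≡v = unwind-fixed fixed

AllPairs-split : ∀ {R : ℕ × ℕ → ℕ × ℕ → Set} xs {z ys} →
  AllPairs R (xs ++ z ∷ ys) → All (λ w → R w z) xs × AllPairs R (z ∷ ys)
AllPairs-split [] sorted = [] , sorted
AllPairs-split (w ∷ xs) (w-first ∷ sorted) with AllPairs-split xs sorted
... | before , after = All.head (All.++⁻ʳ xs w-first) ∷ before , after

InRange : ℕ → ℕ × ℕ → Set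
InRange n (a , b) = 1 ≤ a × a < b × b ≤ n

IsEdge : ℕ → Adj → ℕ × ℕ → Set
IsEdge n E (a , b) = 1 ≤ a × a < b × b ≤ n × E a b ≡ true

<∸⇒+< : ∀ {i n k} → i < n ∸ k → i + k < n
<∸⇒+< {i} {n} {k} i<n∸k = m≤o∸n⇒m+n≤o (suc i) (<⇒≤ k<n) i<n∸k
  where
  k<n : k < n
  k<n = m∸n≢0⇒n<m (λ n∸k≡0 → n≮0 (subst (i <_) n∸k≡0 i<n∸k))

pairsOfLen-inRange : ∀ n d → All (InRange n) (pairsOfLen n (suc d))
pairsOfLen-inRange n d = All.map⁺ (All.map⁺ (All.applyUpTo⁺₁ _ (n ∸ suc d)
  (λ {i} i< → s≤s z≤n , m<m+n (suc i) (s≤s z≤n) , <∸⇒+< i<)))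

allPairs-inRange : ∀ n → All (InRange n) (allPairs n)
allPairs-inRange n = All.concat⁺ (All.map⁺ (All.map⁺ (All.applyUpTo⁺₂ _ (n ∸ 1) (pairsOfLen-inRange n))))

edgeList-edges : ∀ n E → All (IsEdge n E) (edgeList n E)
edgeList-edges n E = zipWith (λ ((a≥1 , a<b , b≤n) , Eab) → a≥1 , a<b , b≤n , Equivalence.to T-≡ Eab)
  (All.filter⁺ _ (allPairs-inRange n) , All.all-filter _ (allPairs n))

private
  +-swap-outer : ∀ a b c → a + b + c ≡ c + b + a
  +-swap-outer = solve-∀

pairsOfLen-sorted : ∀ n len → AllPairs _≺_ (pairsOfLen n len)
pairsOfLen-sorted n len = AllPairs.map⁺ (AllPairs.map⁺ (AllPairs.applyUpTo⁺₁ _ (n ∸ len)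
  (λ {i} {j} i<j _ → inj₂ (+-swap-outer (suc i) len (suc j) , s≤s i<j))))

pairsOfLen-≺-longer : ∀ n {len len′} → len < len′ →
  All (λ e → All (e ≺_) (pairsOfLen n len′)) (pairsOfLen n len)
pairsOfLen-≺-longer n {len} {len′} len<len′ =
  All.map⁺ (All.map⁺ (All.applyUpTo⁺₂ _ (n ∸ len) λ i →
    All.map⁺ (All.map⁺ (All.applyUpTo⁺₂ _ (n ∸ len′) λ j →
      inj₁ (subst (_< suc j + len′ + suc i) (sym (+-swap-outer (suc i) len (suc j)))
        (+-monoˡ-< (suc i) (+-monoʳ-< (suc j) len<len′)))))))

allPairs-sorted : ∀ n → AllPairs _≺_ (allPairs n)
allPairs-sorted n = AllPairs.concat⁺
  (All.map⁺ (All.map⁺ (All.applyUpTo⁺₂ _ (n ∸ 1) λ d → pairsOfLen-sorted n (suc d))))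
  (AllPairs.map⁺ (AllPairs.map⁺ (AllPairs.applyUpTo⁺₁ _ (n ∸ 1)
    λ d<d′ _ → pairsOfLen-≺-longer n (s≤s d<d′))))

edgeList-sorted : ∀ n E → AllPairs _≺_ (edgeList n E)
edgeList-sorted n E = AllPairs.filter⁺ _ (allPairs-sorted n)

<⇒≡+suc : ∀ {a b} → a < b → ∃ λ d → b ≡ a + suc d
<⇒≡+suc {a} {b} a<b = b ∸ suc a , sym (trans (+-suc a (b ∸ suc a)) (m+[n∸m]≡n a<b))

∈-edgeList : ∀ {n E a b} → IsEdge n E (a , b) → (a , b) ∈ edgeList n E
∈-edgeList {n} {E} {suc i} (_ , a<b , b≤n , Eab) with <⇒≡+suc a<b
... | d , refl = ∈-filter⁺ _ ∈-allPairs (Equivalence.from T-≡ Eab)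
  where
  ∈-allPairs : (suc i , suc i + suc d) ∈ allPairs n
  ∈-allPairs = ∈-concat⁺′
    (∈-map⁺ _ (∈-map⁺ suc (∈-upTo⁺ (m+n≤o⇒m≤o∸n (suc i) b≤n))))
    (∈-map⁺ (pairsOfLen n) (∈-map⁺ suc (∈-upTo⁺ (m+n≤o⇒m≤o∸n (suc d) {1}
      (≤-trans (+-monoʳ-≤ (suc d) (s≤s z≤n)) (subst (_≤ n) (+-comm (suc i) (suc d)) b≤n))))))

crossing-edge : ∀ {n E} → TerrainLike n E → ∀ {a b c d} →
  IsEdge n E (a , c) → IsEdge n E (b , d) → a < b → b < c → c < d → IsEdge n E (a , d)
crossing-edge terrain {a} {b} {c} {d} (a≥1 , _ , _ , Eac) (_ , _ , d≤n , Ebd) a<b b<c c<d =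
  a≥1 , <-trans a<b (<-trans b<c c<d) , d≤n , terrain a b c d a≥1 a<b b<c c<d d≤n Eac Ebd

record Remaining (n : ℕ) (E : Adj) (k : ℕ × ℕ) (R : List (ℕ × ℕ)) : Set where
  field
    sorted : AllPairs _≺_ R
    above : All (k ≺_) R
    edges : All (IsEdge n E) R
    complete : ∀ {f} → IsEdge n E f → k ≺ f → f ∈ R

Remaining-step : ∀ {n E k a b R} → Remaining n E k ((a , b) ∷ R) → Remaining n E (a , b) R
Remaining-step {n} {E} {k} {a} {b} {R} rem = record
  { sorted = AllPairs.tail sorted
  ; above = AllPairs.head sorted
  ; edges = All.tail edges
  ; complete = complete′
  }
  where
  open Remaining rem
  complete′ : ∀ {f} → IsEdge n E f → (a , b) ≺ f → f ∈ R
  complete′ f-edge ab≺f with complete f-edge (≺-trans (All.head above) ab≺f)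
  ... | here refl = ⊥-elim (≺-irrefl ab≺f)
  ... | there f∈R = f∈R

data Slot : Set where
  odd even : Slot

slot : Slot → ℕ → ℕ → ℕ
slot odd  l r = 2 * r ∸ 1
slot even l r = 2 * l

-- In the state even/odd the tokens would end in non-edge configuration; the pending
-- edge {lA, rB} ∈ R guarantees that this state is left before R is exhausted.
Related : Slot → Slot → (lA rA lB rB : ℕ) → List (ℕ × ℕ) → Set
Related odd  odd  lA rA lB rB R = rA < rB
Related even even lA rA lB rB R = lA < lB
Related odd  even lA rA lB rB R = lA < lB ⊎ rA < rB ⊎ (lA ≡ lB × rA ≡ rB)
Related even odd  lA rA lB rB R = lA < lB × rA < rB × (lA , rB) ∈ R

EdgeConfigured : ℕ → ℕ → Set
EdgeConfigured u w = (π₀ u < π₀ w) ⇔ (π₀ u % 2 ≡ π₀ w % 2)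

module Tracking {n : ℕ} {E : Adj} (terrain : TerrainLike n E) {x y : ℕ} (x<y : x < y) where

  record Spanning (R : List (ℕ × ℕ)) (l r : ℕ) : Set where
    constructor spanning
    field
      isEdge : IsEdge n E (l , r)
      l≤x : l ≤ x
      y≤r : y ≤ r
      precedes : All ((l , r) ≺_) R

  open Spanning

  left≥1 : ∀ {R l r} → Spanning R l r → 1 ≤ l
  left≥1 (spanning (l≥1 , _) _ _ _) = l≥1

  right≥1 : ∀ {R l r} → Spanning R l r → 1 ≤ r
  right≥1 (spanning (l≥1 , l<r , _) _ _ _) = <-trans l≥1 l<r

  left<right : ∀ {R R′ lA rA lB rB} → Spanning R lA rA → Spanning R′ lB rB → lB < rA
  left<right sA sB = ≤-trans (s≤s (l≤x sB)) (≤-trans x<y (y≤r sA))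

  precedes-next : ∀ {e R l r} → Spanning (e ∷ R) l r → (l , r) ≺ e
  precedes-next s = All.head (precedes s)

  skip : ∀ {e R l r} → Spanning (e ∷ R) l r → Spanning R l r
  skip (spanning isEdge l≤x y≤r (_ ∷ precedes)) = spanning isEdge l≤x y≤r precedes

  record Config (R : List (ℕ × ℕ)) : Set where
    constructor config
    field
      slotA slotB : Slot
      lA rA lB rB : ℕ
      spanA : Spanning R lA rA
      spanB : Spanning R lB rB
      related : Related slotA slotB lA rA lB rB R

    valueA valueB : ℕ
    valueA = slot slotA lA rA
    valueB = slot slotB lB rB

  open Config

  Image : ∀ {R} → ℕ × ℕ → ℕ → ℕ → Config R → Set
  Image e u w c = τ e u ≡ valueA c × τ e w ≡ valueB c

  module Step {a b R} (ab-edge : IsEdge n E (a , b)) (rem : Remaining n E (a , b) R) where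
    open Remaining rem

    b≥1 : 1 ≤ b
    b≥1 = <-trans (proj₁ ab-edge) (proj₁ (proj₂ ab-edge))

    fresh : a ≤ x → y ≤ b → Spanning R a b
    fresh a≤x y≤b = spanning ab-edge a≤x y≤b above

    advance-odd-odd : ∀ {lA rA lB rB} → Spanning ((a , b) ∷ R) lA rA → Spanning ((a , b) ∷ R) lB rB →
      rA < rB → Σ (Config R) (Image (a , b) (2 * rA ∸ 1) (2 * rB ∸ 1))
    advance-odd-odd {lA} {rA} {lB} {rB} sA sB rA<rB
      with τ-on-odd (right≥1 sA) b≥1 (precedes-next sA) | τ-on-odd (right≥1 sB) b≥1 (precedes-next sB)
    ... | inj₁ (refl , _ , _) | inj₁ (refl , _ , _) = ⊥-elim (<-irrefl refl rA<rB)
    ... | inj₁ (refl , a<lA , τA) | inj₂ (_ , τB) =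
      config even odd a b lB rB (fresh (≤-trans (<⇒≤ a<lA) (l≤x sA)) (y≤r sA)) (skip sB)
        (a<lB , rA<rB , complete aRB-edge (<⇒≺-sameLeft rA<rB)) , τA , τB
      where
      a<lB = ≺-endsLater⇒startsLater rA<rB (precedes-next sB)
      aRB-edge = crossing-edge terrain ab-edge (isEdge sB) a<lB (left<right sA sB) rA<rB
    ... | inj₂ (_ , τA) | inj₁ (refl , a<lB , τB) =
      config odd even lA rA a b (skip sA) (fresh (≤-trans (<⇒≤ a<lB) (l≤x sB)) (y≤r sB))
        (inj₂ (inj₁ rA<rB)) , τA , τB
    ... | inj₂ (_ , τA) | inj₂ (_ , τB) = config odd odd lA rA lB rB (skip sA) (skip sB) rA<rB , τA , τB

    advance-even-even : ∀ {lA rA lB rB} → Spanning ((a , b) ∷ R) lA rA → Spanning ((a , b) ∷ R) lB rB →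
      lA < lB → Σ (Config R) (Image (a , b) (2 * lA) (2 * lB))
    advance-even-even {lA} {rA} {lB} {rB} sA sB lA<lB
      with τ-on-even b≥1 (precedes-next sA) | τ-on-even b≥1 (precedes-next sB)
    ... | inj₁ (refl , _ , _) | inj₁ (refl , _ , _) = ⊥-elim (<-irrefl refl lA<lB)
    ... | inj₁ (refl , rA<b , τA) | inj₂ (_ , τB) =
      config odd even a b lB rB (fresh (l≤x sA) (≤-trans (y≤r sA) (<⇒≤ rA<b))) (skip sB)
        (inj₁ lA<lB) , τA , τB
    ... | inj₂ (_ , τA) | inj₁ (refl , rB<b , τB) =
      config even odd lA rA a b (skip sA) (fresh (l≤x sB) (≤-trans (y≤r sB) (<⇒≤ rB<b)))
        (lA<lB , rA<b , complete lAb-edge (>⇒≺-sameRight lA<lB)) , τA , τB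
      where
      rA<b = ≺-startsEarlier⇒endsEarlier lA<lB (precedes-next sA)
      lAb-edge = crossing-edge terrain (isEdge sA) ab-edge lA<lB (left<right sA sB) rA<b
    ... | inj₂ (_ , τA) | inj₂ (_ , τB) = config even even lA rA lB rB (skip sA) (skip sB) lA<lB , τA , τB

    advance-odd-even : ∀ {lA rA lB rB} → Spanning ((a , b) ∷ R) lA rA → Spanning ((a , b) ∷ R) lB rB →
      Related odd even lA rA lB rB ((a , b) ∷ R) → Σ (Config R) (Image (a , b) (2 * rA ∸ 1) (2 * lB))
    advance-odd-even {lA} {rA} {lB} {rB} sA sB rel
      with τ-on-odd (right≥1 sA) b≥1 (precedes-next sA) | τ-on-even b≥1 (precedes-next sB)
    ... | inj₁ (refl , a<lA , _) | inj₁ (refl , rB<b , _) = ⊥-elim (not-both rel)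
      where
      not-both : ¬ Related odd even lA b a rB R
      not-both (inj₁ lA<a) = <-asym lA<a a<lA
      not-both (inj₂ (inj₁ b<rB)) = <-asym b<rB rB<b
      not-both (inj₂ (inj₂ (refl , _))) = <-irrefl refl a<lA
    ... | inj₁ (refl , a<lA , τA) | inj₂ (_ , τB) =
      config even even a b lB rB (fresh (≤-trans (<⇒≤ a<lA) (l≤x sA)) (y≤r sA)) (skip sB)
        (a<lB rel) , τA , τB
      where
      a<lB : Related odd even lA b lB rB R → a < lB
      a<lB (inj₁ lA<lB) = <-trans a<lA lA<lB
      a<lB (inj₂ (inj₁ b<rB)) = ≺-endsLater⇒startsLater b<rB (precedes-next sB)
      a<lB (inj₂ (inj₂ (refl , _))) = a<lA
    ... | inj₂ (_ , τA) | inj₁ (refl , rB<b , τB) =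
      config odd odd lA rA a b (skip sA) (fresh (l≤x sB) (≤-trans (y≤r sB) (<⇒≤ rB<b)))
        (rA<b rel) , τA , τB
      where
      rA<b : Related odd even lA rA a rB R → rA < b
      rA<b (inj₁ lA<a) = ≺-startsEarlier⇒endsEarlier lA<a (precedes-next sA)
      rA<b (inj₂ (inj₁ rA<rB)) = <-trans rA<rB rB<b
      rA<b (inj₂ (inj₂ (_ , refl))) = rB<b
    ... | inj₂ (_ , τA) | inj₂ (_ , τB) = config odd even lA rA lB rB (skip sA) (skip sB) rel , τA , τB

    advance-even-odd : ∀ {lA rA lB rB} → Spanning ((a , b) ∷ R) lA rA → Spanning ((a , b) ∷ R) lB rB →
      Related even odd lA rA lB rB ((a , b) ∷ R) → Σ (Config R) (Image (a , b) (2 * lA) (2 * rB ∸ 1))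
    advance-even-odd {lA} {rA} {lB} {rB} sA sB (lA<lB , rA<rB , pending)
      with τ-on-even b≥1 (precedes-next sA) | τ-on-odd (right≥1 sB) b≥1 (precedes-next sB)
    ... | inj₁ (refl , _ , τA) | inj₁ (refl , _ , τB) =
      config odd even a b a b (fresh (l≤x sA) (y≤r sB)) (fresh (l≤x sA) (y≤r sB))
        (inj₂ (inj₂ (refl , refl))) , τA , τB
    ... | inj₁ (refl , rA<b , τA) | inj₂ (b≢rB , τB) =
      config odd odd a b lB rB (fresh (l≤x sA) (≤-trans (y≤r sA) (<⇒≤ rA<b))) (skip sB)
        (b<rB pending) , τA , τB
      where
      b<rB : (a , rB) ∈ (a , b) ∷ R → b < rB
      b<rB (here refl) = ⊥-elim (b≢rB refl)
      b<rB (there p) = ≺-sameLeft⇒< (All.lookup above p)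
    ... | inj₂ (a≢lA , τA) | inj₁ (refl , a<lB , τB) =
      config even even lA rA a b (skip sA) (fresh (≤-trans (<⇒≤ a<lB) (l≤x sB)) (y≤r sB))
        (lA<a pending) , τA , τB
      where
      lA<a : (lA , b) ∈ (a , b) ∷ R → lA < a
      lA<a (here refl) = ⊥-elim (a≢lA refl)
      lA<a (there p) = ≺-sameRight⇒> (All.lookup above p)
    ... | inj₂ (a≢lA , τA) | inj₂ (_ , τB) =
      config even odd lA rA lB rB (skip sA) (skip sB) (lA<lB , rA<rB , still-pending pending) , τA , τB
      where
      still-pending : (lA , rB) ∈ (a , b) ∷ R → (lA , rB) ∈ R
      still-pending (here refl) = ⊥-elim (a≢lA refl)
      still-pending (there p) = p

    advance : (c : Config ((a , b) ∷ R)) → Σ (Config R) (Image (a , b) (valueA c) (valueB c))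
    advance (config odd  odd  _ _ _ _ sA sB rel) = advance-odd-odd sA sB rel
    advance (config even even _ _ _ _ sA sB rel) = advance-even-even sA sB rel
    advance (config odd  even _ _ _ _ sA sB rel) = advance-odd-even sA sB rel
    advance (config even odd  _ _ _ _ sA sB rel) = advance-even-odd sA sB rel

  final : (c : Config []) → EdgeConfigured (valueA c) (valueB c)
  final (config odd odd _ rA _ rB sA sB rA<rB)
    rewrite π₀-odd (right≥1 sA) | π₀-odd (right≥1 sB) | 2*-%2 rA | 2*-%2 rB
    = mk⇔ (λ _ → refl) (λ _ → *-monoʳ-< 2 rA<rB)
  final (config even even lA _ lB _ sA sB lA<lB)
    rewrite π₀-even (left≥1 sA) | π₀-even (left≥1 sB) | 2*∸1-%2 (left≥1 sA) | 2*∸1-%2 (left≥1 sB)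
    = mk⇔ (λ _ → refl) (λ _ → 2*∸1<2*∸1 (left≥1 sA) lA<lB)
  final (config odd even _ rA lB _ sA sB _)
    rewrite π₀-odd (right≥1 sA) | π₀-even (left≥1 sB) | 2*-%2 rA | 2*∸1-%2 (left≥1 sB)
    = mk⇔ (λ 2rA<2lB∸1 → ⊥-elim (<-asym 2rA<2lB∸1 2lB∸1<2rA)) (λ ())
    where 2lB∸1<2rA = 2*∸1<2* (left≥1 sB) (<⇒≤ (left<right sA sB))
  final (config even odd _ _ _ _ _ _ (_ , _ , ()))

  edgeConfigured : ∀ {k R} → Remaining n E k R → (c : Config R) →
    EdgeConfigured (unwind R (valueA c)) (unwind R (valueB c))
  edgeConfigured {R = []} _ c = final c
  edgeConfigured {R = (a , b) ∷ R} rem c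
    with Step.advance (All.head (Remaining.edges rem)) (Remaining-step rem) c
  ... | c′ , τA≡ , τB≡ rewrite τA≡ | τB≡ = edgeConfigured (Remaining-step rem) c′

⪯-Minimal : ℕ → Adj → ℕ → ℕ → Set
⪯-Minimal n E x y = ∀ a b → 1 ≤ a → a < b → b ≤ n → E a b ≡ true → (a , b) ⪯ (x , y) → (a , b) ≡ (x , y)

τ-fixes-below-minimal : ∀ {n E x y a b} → ⪯-Minimal n E x y → 1 ≤ y → IsEdge n E (a , b) → (a , b) ≺ (x , y) →
  τ (a , b) (2 * x) ≡ 2 * x × τ (a , b) (2 * y ∸ 1) ≡ 2 * y ∸ 1
τ-fixes-below-minimal {n} {E} {x} {y} {a} {b} minimal y≥1 (a≥1 , a<b , b≤n , Eab) ab≺xy =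
  swap-other (λ eq → a≢x (sym (*-cancelˡ-≡ x a 2 eq))) (even≢2*∸1 x b≥1) ,
  swap-other (λ eq → even≢2*∸1 a y≥1 (sym eq)) (λ eq → b≢y (sym (2*∸1-injective y≥1 b≥1 eq)))
  where
  b≥1 = <-trans a≥1 a<b
  a≢x : a ≢ x
  a≢x refl = <-irrefl (cong proj₂ (minimal a b a≥1 a<b b≤n Eab (≤-refl , a<b , <⇒≤ b<y))) b<y
    where b<y = ≺-sameLeft⇒< ab≺xy
  b≢y : b ≢ y
  b≢y refl = <-irrefl (sym (cong proj₁ (minimal a b a≥1 a<b b≤n Eab (<⇒≤ x<a , a<b , ≤-refl)))) x<a
    where x<a = ≺-sameRight⇒> ab≺xy

module AroundEdge (n : ℕ) (E : Adj) {x y pre post} (split : edgeList n E ≡ pre ++ (x , y) ∷ post) where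

  private
    sorted-split : All (_≺ (x , y)) pre × AllPairs _≺_ ((x , y) ∷ post)
    sorted-split = AllPairs-split pre (subst (AllPairs _≺_) split (edgeList-sorted n E))

    edges : All (IsEdge n E) (pre ++ (x , y) ∷ post)
    edges = subst (All (IsEdge n E)) split (edgeList-edges n E)

  remaining : Remaining n E (x , y) post
  remaining = record
    { sorted = AllPairs.tail (proj₂ sorted-split)
    ; above = AllPairs.head (proj₂ sorted-split)
    ; edges = All.tail (All.++⁻ʳ pre edges)
    ; complete = complete
    }
    where
    complete : ∀ {f} → IsEdge n E f → (x , y) ≺ f → f ∈ post
    complete f-edge xy≺f with ∈-++⁻ pre (subst (_ ∈_) split (∈-edgeList f-edge))
    ... | inj₁ f∈pre = ⊥-elim (≺-asym xy≺f (All.lookup (proj₁ sorted-split) f∈pre))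
    ... | inj₂ (here refl) = ⊥-elim (≺-irrefl xy≺f)
    ... | inj₂ (there f∈post) = f∈post

  module _ (minimal : ⪯-Minimal n E x y) (y≥1 : 1 ≤ y) where

    private
      fixes : All (λ e → τ e (2 * x) ≡ 2 * x × τ e (2 * y ∸ 1) ≡ 2 * y ∸ 1) pre
      fixes = zipWith (λ (e-edge , e≺xy) → τ-fixes-below-minimal minimal y≥1 e-edge e≺xy)
        (All.++⁻ˡ pre edges , proj₁ sorted-split)

    unwind-2x : unwind (edgeList n E) (2 * x) ≡ unwind post (2 * y ∸ 1)
    unwind-2x = begin
      unwind (edgeList n E) (2 * x)                  ≡⟨ cong (λ es → unwind es (2 * x)) split ⟩
      unwind (pre ++ (x , y) ∷ post) (2 * x)         ≡⟨ unwind-++ pre _ (2 * x) ⟩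
      unwind post (τ (x , y) (unwind pre (2 * x)))   ≡⟨ cong (unwind post ∘ τ (x , y)) (unwind-fixed (All.map proj₁ fixes)) ⟩
      unwind post (τ (x , y) (2 * x))                ≡⟨ cong (unwind post) (swap-left (2 * x) (2 * y ∸ 1)) ⟩
      unwind post (2 * y ∸ 1)                        ∎
      where open ≡-Reasoning

    unwind-2y∸1 : unwind (edgeList n E) (2 * y ∸ 1) ≡ unwind post (2 * x)
    unwind-2y∸1 = begin
      unwind (edgeList n E) (2 * y ∸ 1)                  ≡⟨ cong (λ es → unwind es (2 * y ∸ 1)) split ⟩
      unwind (pre ++ (x , y) ∷ post) (2 * y ∸ 1)         ≡⟨ unwind-++ pre _ (2 * y ∸ 1) ⟩
      unwind post (τ (x , y) (unwind pre (2 * y ∸ 1)))   ≡⟨ cong (unwind post ∘ τ (x , y)) (unwind-fixed (All.map proj₂ fixes)) ⟩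
      unwind post (τ (x , y) (2 * y ∸ 1))                ≡⟨ cong (unwind post) (swap-right (2 * x) (2 * y ∸ 1)) ⟩
      unwind post (2 * x)                                ∎
      where open ≡-Reasoning

EdgeConfigured⇒EdgeConfig : ∀ n E {i j} →
  EdgeConfigured (unwind (edgeList n E) i) (unwind (edgeList n E) j) → EdgeConfig n (Π n E) i j
EdgeConfigured⇒EdgeConfig n E configured p q p≥1 _ q≥1 _ Πp≡i Πq≡j =
  subst₂ (λ p q → (p < q) ⇔ (p % 2 ≡ q % 2)) (position p≥1 Πp≡i) (position q≥1 Πq≡j) configured
  where
  position : ∀ {p v} → 1 ≤ p → Π n E p ≡ v → π₀ (unwind (edgeList n E) v) ≡ p
  position p≥1 Πp≡v = trans (cong π₀ (sym (unwind-inverts (edgeList n E) Πp≡v))) (π₀-involutive p≥1)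

mainTheorem9 : (n : ℕ) (E : Adj) → TerrainLike n E →
    (x y : ℕ) → 1 ≤ x → x < y → y ≤ n → E x y ≡ true →
    (∀ a b → 1 ≤ a → a < b → b ≤ n → E a b ≡ true →
      (a , b) ⪯ (x , y) → (a , b) ≡ (x , y)) →
    EdgeConfig n (Π n E) (2 * x) (2 * y ∸ 1)
mainTheorem9 n E terrain x y x≥1 x<y y≤n Exy minimal
  with ∈-∃++ (∈-edgeList {n} {E} (x≥1 , x<y , y≤n , Exy))
... | pre , post , split = EdgeConfigured⇒EdgeConfig n E
  (subst₂ EdgeConfigured (sym (unwind-2x minimal y≥1)) (sym (unwind-2y∸1 minimal y≥1)) tracked)
  where
  open AroundEdge n E split
  open Tracking terrain x<y
  y≥1 = <-trans x≥1 x<y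
  start : Spanning post x y
  start = spanning (x≥1 , x<y , y≤n , Exy) ≤-refl ≤-refl (Remaining.above remaining)
  tracked : EdgeConfigured (unwind post (2 * y ∸ 1)) (unwind post (2 * x))
  tracked = edgeConfigured remaining (config odd even x y x y start start (inj₂ (inj₂ (refl , refl))))
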